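{- Let $\sigma,\tau\in S_n$. Then $$T_L(\sigma\vee_R\tau)=T\cap V_{S_n}(\sigma,\tau).$$
   Context: $S_n$ is the symmetric group on $[n]=\{1,\dots,n\}$, viewed as the Coxeter group of type $A_{n-1}$ with simple reflections $S=\{(i\ i+1)\mid i\in[n-1]\}$; its reflections are the transpositions $T=\{(i\ j)\mid 1\leq i<j\leq n\}$. Permutations compose as functions (right to left). The length $\ell(\sigma)$ equals the number of pairs $i<j$ with $\sigma(i)>\sigma(j)$. Right weak order: $\sigma\leq_R\tau$ iff a reduced expression of $\sigma$ is a prefix of a reduced expression of $\tau$; $\sigma\vee_R\tau$ is the join in this lattice. $T_L(w)=\{t\in T\mid \ell(tw)<\ell(w)\}$. Bruhat graph: vertices $S_n$, directed edge $x\xrightarrow{t}y$ labeled $t\in T$ iff $y=tx$ and $\ell(x)<\ell(y)$. A $(\sigma,\tau)$-Bruhat path is a directed path in the Bruhat graph starting at $e$ whose edge labels all lie in $T_L(\sigma)\cup T_L(\tau)$; $V_{S_n}(\sigma,\tau)$ is the set of all vertices of all $(\sigma,\tau)$-Bruhat paths. -}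

module Defs where

open import Data.Nat as ℕ using (ℕ; suc)
open import Data.Fin using (Fin; toℕ; _<_; _≟_)
open import Data.Fin.Properties using (_<?_)
open import Data.Bool using (if_then_else_)
open import Data.List using (List; []; _∷_; _++_; length; filter; cartesianProduct; allFin)
open import Data.Product using (Σ; _×_; _,_; proj₁; proj₂; ∃)
open import Data.Sum using (_⊎_)
open import Relation.Nullary.Decidable using (⌊_⌋; _×-dec_)
open import Relation.Binary.PropositionalEquality using (_≡_)
open import Function using (_∘_; id)

-- Permutations of [n] are represented as functions Fin n → Fin n
-- (bijectivity is imposed where needed); equality is pointwise.
Fun : ℕ → Set
Fun n = Fin n → Fin n

_≈_ : ∀ {n} → Fun n → Fun n → Set
f ≈ g = ∀ x → f x ≡ g x

transp : ∀ {n} → Fin n → Fin n → Fun n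
transp a b x = if ⌊ x ≟ a ⌋ then b else (if ⌊ x ≟ b ⌋ then a else x)

len : ∀ {n} → Fun n → ℕ
len {n} σ = length (filter (λ p → (proj₁ p <? proj₂ p) ×-dec (σ (proj₂ p) <? σ (proj₁ p)))
                           (cartesianProduct (allFin n) (allFin n)))

record SimpleRefl (n : ℕ) : Set where
  field
    i j : Fin n
    adj : toℕ j ≡ suc (toℕ i)

prod : ∀ {n} → List (SimpleRefl n) → Fun n
prod [] = id
prod (s ∷ w) = transp (SimpleRefl.i s) (SimpleRefl.j s) ∘ prod w

_≤R_ : ∀ {n} → Fun n → Fun n → Set
_≤R_ {n} σ τ = Σ (List (SimpleRefl n)) λ u → Σ (List (SimpleRefl n)) λ v →
  (prod u ≈ σ) × (length u ≡ len σ) × (prod (u ++ v) ≈ τ) × (length (u ++ v) ≡ len τ)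

IsJoinR : ∀ {n} → Fun n → Fun n → Fun n → Set
IsJoinR {n} σ τ ρ = (σ ≤R ρ) × (τ ≤R ρ) × (∀ (π : Fun n) → σ ≤R π → τ ≤R π → ρ ≤R π)

InTL : ∀ {n} → Fun n → Fin n → Fin n → Set
InTL w a b = len (transp a b ∘ w) ℕ.< len w

data BruhatReach {n} (σ τ : Fun n) : Fun n → Set where
  start : ∀ {w} → w ≈ id → BruhatReach σ τ w
  step  : ∀ {x y} (a b : Fin n) → a < b →
          InTL σ a b ⊎ InTL τ a b →
          BruhatReach σ τ x →
          len x ℕ.< len (transp a b ∘ x) →
          y ≈ (transp a b ∘ x) →
          BruhatReach σ τ y

module Submission where

-- Left inversions are read off positions: (c d), c < d, lies in T_L(w) iff w places d before c,
-- and σ ≤R π iff T_L(σ) ⊆ T_L(π).  Let ρ = σ ∨_R τ and U = T_L(σ) ∪ T_L(τ) ⊆ T_L(ρ).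
-- A Bruhat path with labels in U cannot reach (a b) ∉ T_L(ρ): the values that ρ places no later
-- than a form a set closed under the labels, and the sum of the positions holding them never
-- increases along such a path, while it is larger at (a b) than at e.  Conversely, if b is
-- reached from a by an increasing chain of labels in U, conjugating along the chain builds a
-- Bruhat path to (a b); if it is not, some upper bound of σ and τ does not contain (a b) in
-- its left inversions, so neither does ρ.

open import Defs
open import Data.Bool using (true; false; if_then_else_)
open import Data.Empty using (⊥; ⊥-elim)
open import Data.Fin as F using (Fin; toℕ; _≟_; _<_; _≤_)
open import Data.Fin.Properties as FP using (_<?_; _≤?_)
open import Data.List as L using (List; []; _∷_; _++_; length; filter; cartesianProduct; tabulate; map)
import Data.List.Properties as LP
open import Data.Nat as ℕ using (ℕ; zero; suc; _+_; _*_; z≤n; s≤s)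
import Data.Nat.Properties as ℕP
open import Data.Nat.Tactic.RingSolver using (solve-∀)
open import Data.Product using (Σ; ∃; _×_; _,_; proj₁; proj₂)
open import Data.Sum using (_⊎_; inj₁; inj₂)
open import Function using (_∘_; id)
open import Level using (0ℓ)
open import Function.Definitions using (Injective)
open import Relation.Binary using (tri<; tri≈; tri>)
open import Relation.Binary.PropositionalEquality
open import Relation.Nullary using (Dec; yes; no; does; ¬_)
open import Relation.Nullary.Decidable using (_×-dec_; _⊎-dec_)
open import Relation.Unary using (Pred; Decidable)
open import Relation.Binary.Construct.Closure.ReflexiveTransitive as Star using (Star; ε; _◅_; _◅◅_)
open import Algebra.Properties.CommutativeMonoid.Sum ℕP.+-0-commutativeMonoid
  using (sum; sum-cong-≗; ∑-distrib-+; sum-replicate-zero)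
open import Algebra.Properties.CommutativeSemigroup ℕP.+-commutativeSemigroup
  using (x∙yz≈y∙xz)

𝟙 : ∀ {P : Set} → Dec P → ℕ
𝟙 d = if does d then 1 else 0

𝟙-yes : ∀ {P : Set} (d : Dec P) → P → 𝟙 d ≡ 1
𝟙-yes (yes _) _ = refl
𝟙-yes (no ¬p) p = ⊥-elim (¬p p)

𝟙-no : ∀ {P : Set} (d : Dec P) → ¬ P → 𝟙 d ≡ 0
𝟙-no (yes p) ¬p = ⊥-elim (¬p p)
𝟙-no (no _) _ = refl

𝟙≤1 : ∀ {P : Set} (d : Dec P) → 𝟙 d ℕ.≤ 1
𝟙≤1 (yes _) = s≤s z≤n
𝟙≤1 (no _) = z≤n

𝟙-mono : ∀ {P Q : Set} (d : Dec P) (e : Dec Q) → (P → Q) → 𝟙 d ℕ.≤ 𝟙 e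
𝟙-mono (yes p) e f = ℕP.≤-reflexive (sym (𝟙-yes e (f p)))
𝟙-mono (no _) e f = z≤n

𝟙-× : ∀ {P Q : Set} (d : Dec P) (e : Dec Q) → 𝟙 (d ×-dec e) ≡ 𝟙 d * 𝟙 e
𝟙-× (yes _) (yes _) = refl
𝟙-× (yes _) (no _) = refl
𝟙-× (no _) _ = refl

𝟙-rearrangement : ∀ {P Q : Set} (dP : Dec P) (dQ : Dec Q) → (P → Q) → ∀ {p q} → p ℕ.≤ q →
  𝟙 dQ * p + 𝟙 dP * q ℕ.≤ 𝟙 dP * p + 𝟙 dQ * q
𝟙-rearrangement (yes _) (yes _) _ _ = ℕP.≤-refl
𝟙-rearrangement (yes P) (no ¬Q) P⇒Q _ = ⊥-elim (¬Q (P⇒Q P))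
𝟙-rearrangement (no _) (yes _) _ {p} {q} p≤q =
  subst (ℕ._≤ 1 * q) (sym (ℕP.+-identityʳ (1 * p))) (ℕP.*-monoʳ-≤ 1 p≤q)
𝟙-rearrangement (no _) (no _) _ _ = z≤n

sum-mono : ∀ {n} {f g : Fin n → ℕ} → (∀ i → f i ℕ.≤ g i) → sum f ℕ.≤ sum g
sum-mono {zero} le = z≤n
sum-mono {suc n} le = ℕP.+-mono-≤ (le F.zero) (sum-mono (le ∘ F.suc))

erase : ∀ {n} → Fin n → (Fin n → ℕ) → Fin n → ℕ
erase p f i = if does (i ≟ p) then 0 else f i

sum-erase : ∀ {n} (f : Fin n → ℕ) (p : Fin n) → sum f ≡ f p + sum (erase p f)
sum-erase {suc n} f F.zero = refl
sum-erase {suc n} f (F.suc p) =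
  trans (cong (f F.zero +_) (sum-erase (f ∘ F.suc) p)) (x∙yz≈y∙xz (f F.zero) (f (F.suc p)) _)

erase-≢ : ∀ {n} {p i : Fin n} (f : Fin n → ℕ) → i ≢ p → erase p f i ≡ f i
erase-≢ {p = p} {i} f i≢p with i ≟ p
... | yes i≡p = ⊥-elim (i≢p i≡p)
... | no _ = refl

erase-pointwise : ∀ {n} {p : Fin n} (R : ℕ → ℕ → Set) → R 0 0 → {f g : Fin n → ℕ} →
  ∀ i → (i ≢ p → R (f i) (g i)) → R (erase p f i) (erase p g i)
erase-pointwise {p = p} R r00 i fRg with i ≟ p
... | yes _ = r00
... | no i≢p = fRg i≢p

sum-mono-< : ∀ {n} {f g : Fin n → ℕ} (p : Fin n) → (∀ i → f i ℕ.≤ g i) → f p ℕ.< g p → sum f ℕ.< sum g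
sum-mono-< {f = f} {g} p le lt rewrite sum-erase f p | sum-erase g p =
  ℕP.+-mono-<-≤ lt (sum-mono (λ i → erase-pointwise ℕ._≤_ z≤n {f} {g} i (λ _ → le i)))

sumExcept : ∀ {n} → Fin n → Fin n → (Fin n → ℕ) → ℕ
sumExcept p q f = sum (erase q (erase p f))

sumExcept-pointwise : ∀ {n} {p q : Fin n} (R : ℕ → ℕ → Set) → R 0 0 → {f g : Fin n → ℕ} →
  (∀ i → i ≢ p → i ≢ q → R (f i) (g i)) → ∀ i → R (erase q (erase p f) i) (erase q (erase p g) i)
sumExcept-pointwise {p = p} R r00 {f} {g} fRg i =
  erase-pointwise R r00 {erase p f} {erase p g} i (λ i≢q → erase-pointwise R r00 {f} {g} i (λ i≢p → fRg i i≢p i≢q))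

sumExcept-cong : ∀ {n} {p q : Fin n} {f g : Fin n → ℕ} →
  (∀ i → i ≢ p → i ≢ q → f i ≡ g i) → sumExcept p q f ≡ sumExcept p q g
sumExcept-cong eq = sum-cong-≗ (sumExcept-pointwise _≡_ refl eq)

sumExcept-mono : ∀ {n} {p q : Fin n} {f g : Fin n → ℕ} →
  (∀ i → i ≢ p → i ≢ q → f i ℕ.≤ g i) → sumExcept p q f ℕ.≤ sumExcept p q g
sumExcept-mono le = sum-mono (sumExcept-pointwise ℕ._≤_ z≤n le)

sumExcept-+ : ∀ {n} {p q : Fin n} (f g : Fin n → ℕ) →
  sumExcept p q (λ i → f i + g i) ≡ sumExcept p q f + sumExcept p q g
sumExcept-+ {p = p} {q} f g =
  trans (sum-cong-≗ erase-+) (∑-distrib-+ (erase q (erase p f)) (erase q (erase p g)))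
  where
    erase-+ : ∀ i → erase q (erase p (λ j → f j + g j)) i ≡ erase q (erase p f) i + erase q (erase p g) i
    erase-+ i with i ≟ q
    ... | yes _ = refl
    ... | no _ with i ≟ p
    ...   | yes _ = refl
    ...   | no _ = refl

sum-erase₂ : ∀ {n} (f : Fin n → ℕ) {p q : Fin n} → p ≢ q → sum f ≡ f p + f q + sumExcept p q f
sum-erase₂ f {p} {q} p≢q = begin
  sum f                                            ≡⟨ sum-erase f p ⟩
  f p + sum (erase p f)                            ≡⟨ cong (f p +_) (sum-erase (erase p f) q) ⟩
  f p + (erase p f q + sumExcept p q f)            ≡⟨ cong (λ x → f p + (x + sumExcept p q f)) (erase-≢ f (p≢q ∘ sym)) ⟩
  f p + (f q + sumExcept p q f)                    ≡⟨ ℕP.+-assoc (f p) (f q) _ ⟨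
  f p + f q + sumExcept p q f                      ∎
  where open ≡-Reasoning

sum²-erase₂ : ∀ {n} (H : Fin n → Fin n → ℕ) {p q : Fin n} → p ≢ q →
  sum (λ a → sum (H a)) ≡
  H p p + H p q + H q p + H q q +
  (sumExcept p q (λ k → H p k + H q k + H k p + H k q) + sumExcept p q (λ a → sumExcept p q (H a)))
sum²-erase₂ H {p} {q} p≢q = begin
  sum (λ a → sum (H a))
    ≡⟨ sum-cong-≗ (λ a → sum-erase₂ (H a) p≢q) ⟩
  sum (λ a → H a p + H a q + sumExcept p q (H a))
    ≡⟨ ∑-distrib-+ (λ a → H a p + H a q) _ ⟩
  sum (λ a → H a p + H a q) + sum (λ a → sumExcept p q (H a))
    ≡⟨ cong (_+ sum (λ a → sumExcept p q (H a))) (∑-distrib-+ (λ a → H a p) (λ a → H a q)) ⟩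
  sum (λ a → H a p) + sum (λ a → H a q) + sum (λ a → sumExcept p q (H a))
    ≡⟨ cong₂ _+_ (cong₂ _+_ (sum-erase₂ (λ a → H a p) p≢q) (sum-erase₂ (λ a → H a q) p≢q))
                 (sum-erase₂ (λ a → sumExcept p q (H a)) p≢q) ⟩
  (H p p + H q p + A₁) + (H p q + H q q + A₂) + (B₁ + B₂ + E)
    ≡⟨ regroup (H p p) (H q p) A₁ (H p q) (H q q) A₂ B₁ B₂ E ⟩
  H p p + H p q + H q p + H q q + (B₁ + B₂ + A₁ + A₂ + E)
    ≡⟨ cong (λ s → H p p + H p q + H q p + H q q + (s + E)) cross ⟨
  H p p + H p q + H q p + H q q + (sumExcept p q (λ k → H p k + H q k + H k p + H k q) + E) ∎
  where
    open ≡-Reasoning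
    A₁ = sumExcept p q (λ a → H a p)
    A₂ = sumExcept p q (λ a → H a q)
    B₁ = sumExcept p q (H p)
    B₂ = sumExcept p q (H q)
    E = sumExcept p q (λ a → sumExcept p q (H a))
    regroup : ∀ pp qp a₁ pq qq a₂ b₁ b₂ e →
      pp + qp + a₁ + (pq + qq + a₂) + (b₁ + b₂ + e) ≡ pp + pq + qp + qq + (b₁ + b₂ + a₁ + a₂ + e)
    regroup = solve-∀
    cross : sumExcept p q (λ k → H p k + H q k + H k p + H k q) ≡ B₁ + B₂ + A₁ + A₂
    cross = trans (sumExcept-+ (λ k → H p k + H q k + H k p) (λ k → H k q))
           (cong (_+ A₂) (trans (sumExcept-+ (λ k → H p k + H q k) (λ k → H k p))
           (cong (_+ A₁) (sumExcept-+ (H p) (H q)))))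

sum-ones : ∀ n → sum {n} (λ _ → 1) ≡ n
sum-ones zero = refl
sum-ones (suc n) = cong suc (sum-ones n)

transp-at₁ : ∀ {n} (a b : Fin n) → transp a b a ≡ b
transp-at₁ a b with a ≟ a
... | yes _ = refl
... | no a≢a = ⊥-elim (a≢a refl)

transp-at₂ : ∀ {n} (a b : Fin n) → transp a b b ≡ a
transp-at₂ a b with b ≟ a
... | yes b≡a = b≡a
... | no _ with b ≟ b
...   | yes _ = refl
...   | no b≢b = ⊥-elim (b≢b refl)

transp-fix : ∀ {n} {a b x : Fin n} → x ≢ a → x ≢ b → transp a b x ≡ x
transp-fix {a = a} {b} {x} x≢a x≢b with x ≟ a
... | yes x≡a = ⊥-elim (x≢a x≡a)
... | no _ with x ≟ b
...   | yes x≡b = ⊥-elim (x≢b x≡b)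
...   | no _ = refl

transp-involutive : ∀ {n} (a b x : Fin n) → transp a b (transp a b x) ≡ x
transp-involutive a b x = go (x ≟ a) (x ≟ b)
  where
    go : Dec (x ≡ a) → Dec (x ≡ b) → transp a b (transp a b x) ≡ x
    go (yes refl) _ = trans (cong (transp x b) (transp-at₁ x b)) (transp-at₂ x b)
    go (no _) (yes refl) = trans (cong (transp a x) (transp-at₂ a x)) (transp-at₁ a x)
    go (no x≢a) (no x≢b) = trans (cong (transp a b) (transp-fix x≢a x≢b)) (transp-fix x≢a x≢b)

transp-conjugate : ∀ {n} {a w v : Fin n} → a ≢ w → a ≢ v → w ≢ v →
  ∀ x → transp w v (transp a w (transp w v x)) ≡ transp a v x
transp-conjugate {a = a} {w} {v} a≢w a≢v w≢v x = go (x ≟ a) (x ≟ w) (x ≟ v)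
  where
    go : Dec (x ≡ a) → Dec (x ≡ w) → Dec (x ≡ v) → transp w v (transp a w (transp w v x)) ≡ transp a v x
    go (yes refl) _ _
      rewrite transp-fix a≢w a≢v | transp-at₁ x w | transp-at₁ w v | transp-at₁ x v = refl
    go (no _) (yes refl) _
      rewrite transp-at₁ x v | transp-fix {a = a} {x} (a≢v ∘ sym) (w≢v ∘ sym) | transp-at₂ x v
            | transp-fix (a≢w ∘ sym) w≢v = refl
    go (no x≢a) (no x≢w) (yes refl)
      rewrite transp-at₂ w x | transp-at₂ a w | transp-fix a≢w a≢v | transp-at₂ a x = refl
    go (no x≢a) (no x≢w) (no x≢v)
      rewrite transp-fix x≢w x≢v | transp-fix x≢a x≢w | transp-fix x≢w x≢v | transp-fix x≢a x≢v = refl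

-- Inversions

module _ {A B : Set} {P : Pred (A × B) 0ℓ} (P? : Decidable P) where

  length-filter-tabulate : ∀ {n} (g : Fin n → A × B) → length (filter P? (tabulate g)) ≡ sum (λ i → 𝟙 (P? (g i)))
  length-filter-tabulate {zero} g = refl
  length-filter-tabulate {suc n} g with does (P? (g F.zero))
  ... | true = cong suc (length-filter-tabulate (g ∘ F.suc))
  ... | false = length-filter-tabulate (g ∘ F.suc)

  length-filter-cartesianProduct : ∀ {m n} (g : Fin m → A) (h : Fin n → B) →
    length (filter P? (cartesianProduct (tabulate g) (tabulate h))) ≡ sum (λ i → sum (λ j → 𝟙 (P? (g i , h j))))
  length-filter-cartesianProduct {zero} g h = refl
  length-filter-cartesianProduct {suc m} g h = begin
    length (filter P? (row ++ rest))
      ≡⟨ cong length (LP.filter-++ P? row rest) ⟩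
    length (filter P? row ++ filter P? rest)
      ≡⟨ LP.length-++ (filter P? row) ⟩
    length (filter P? row) + length (filter P? rest)
      ≡⟨ cong₂ _+_ (trans (cong (length ∘ filter P?) (LP.map-tabulate h (g F.zero ,_)))
                          (length-filter-tabulate (λ j → g F.zero , h j)))
                   (length-filter-cartesianProduct (g ∘ F.suc) h) ⟩
    sum (λ i → sum (λ j → 𝟙 (P? (g i , h j)))) ∎
    where
      open ≡-Reasoning
      row = map (g F.zero ,_) (tabulate h)
      rest = cartesianProduct (tabulate (g ∘ F.suc)) (tabulate h)

inversion : ∀ {n} → Fun n → Fin n → Fin n → ℕ
inversion x i j = 𝟙 ((i <? j) ×-dec (x j <? x i))

len-as-sum : ∀ {n} (x : Fun n) → len x ≡ sum (λ i → sum (inversion x i))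
len-as-sum {n} x = length-filter-cartesianProduct _ {n} {n} id id

len-cong : ∀ {n} {x y : Fun n} → x ≈ y → len x ≡ len y
len-cong {x = x} {y} x≈y = begin
  len x                          ≡⟨ len-as-sum x ⟩
  sum (λ i → sum (inversion x i)) ≡⟨ sum-cong-≗ (λ i → sum-cong-≗ (λ j →
                                       cong₂ (λ u v → 𝟙 ((i <? j) ×-dec (u <? v))) (x≈y j) (x≈y i))) ⟩
  sum (λ i → sum (inversion y i)) ≡⟨ len-as-sum y ⟨
  len y                          ∎
  where open ≡-Reasoning

less : ∀ {n} → Fin n → Fin n → ℕ
less u v = 𝟙 (u <? v)

less-yes : ∀ {n} {u v : Fin n} → u < v → less u v ≡ 1
less-yes {u = u} {v} = 𝟙-yes (u <? v)

less-no : ∀ {n} {u v : Fin n} → ¬ u < v → less u v ≡ 0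
less-no {u = u} {v} = 𝟙-no (u <? v)

inversion-as-less : ∀ {n} (x : Fun n) i j → inversion x i j ≡ less i j * less (x j) (x i)
inversion-as-less x i j = 𝟙-× (i <? j) (x j <? x i)

-- The inversions between position k and the positions p, q, when p, q, k carry the values c, d, e.
crossTerm : ∀ {n} (p q k c d e : Fin n) → ℕ
crossTerm p q k c d e = less p k * less e c + less q k * less e d + less k p * less c e + less k q * less d e

-- Exchanging c and d changes nothing for k outside the interval (p, q), and for k inside it
-- cannot lose inversions when c < d.
crossTerm-swap-≤ : ∀ {n} {p q k : Fin n} (c d e : Fin n) → p < q → k ≢ p → k ≢ q →
  (¬ (p < k × k < q) ⊎ c < d) → crossTerm p q k c d e ℕ.≤ crossTerm p q k d c e
crossTerm-swap-≤ {p = p} {q} {k} c d e p<q k≢p k≢q outside-or-ascent with FP.<-cmp k p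
... | tri≈ _ k≡p _ = ⊥-elim (k≢p k≡p)
... | tri< k<p _ _
  rewrite less-no (FP.<-asym k<p) | less-no (FP.<-asym (FP.<-trans k<p p<q))
        | less-yes k<p | less-yes (FP.<-trans k<p p<q)
  = ℕP.≤-reflexive (ℕP.+-comm (1 * less c e) (1 * less d e))
... | tri> _ _ p<k with FP.<-cmp k q
...   | tri≈ _ k≡q _ = ⊥-elim (k≢q k≡q)
...   | tri> _ _ q<k
  rewrite less-yes p<k | less-yes q<k | less-no (FP.<-asym p<k) | less-no (FP.<-asym q<k)
  = ℕP.≤-reflexive (cong (λ s → s + 0 + 0) (ℕP.+-comm (1 * less e c) (1 * less e d)))
...   | tri< k<q _ _ with outside-or-ascent
...     | inj₁ outside = ⊥-elim (outside (p<k , k<q))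
...     | inj₂ c<d
  rewrite less-yes p<k | less-yes k<q | less-no (FP.<-asym p<k) | less-no (FP.<-asym k<q)
  = ℕP.+-mono-≤ (ℕP.+-monoˡ-≤ 0 (ℕP.+-monoˡ-≤ 0 (ℕP.*-monoʳ-≤ 1 e<c⇒e<d)))
                (ℕP.*-monoʳ-≤ 1 d<e⇒c<e)
  where
    e<c⇒e<d : less e c ℕ.≤ less e d
    e<c⇒e<d = 𝟙-mono (e <? c) (e <? d) (λ e<c → FP.<-trans e<c c<d)
    d<e⇒c<e : less d e ℕ.≤ less c e
    d<e⇒c<e = 𝟙-mono (d <? e) (c <? e) (FP.<-trans c<d)

-- Comparing the inversions of x and x ∘ (p q): the pair (p, q) flips, pairs avoiding p and q
-- are unchanged, and the remaining pairs are grouped by their position k other than p, q.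
module _ {n} (x : Fun n) {p q : Fin n} (p<q : p < q) where

  private
    y : Fun n
    y = x ∘ transp p q

    cross : Fun n → Fin n → ℕ
    cross z k = inversion z p k + inversion z q k + inversion z k p + inversion z k q

    rest : Fun n → ℕ
    rest z = sumExcept p q (λ a → sumExcept p q (inversion z a))

    pair : ∀ z → inversion z p p + inversion z p q + inversion z q p + inversion z q q ≡ less (z q) (z p)
    pair z
      rewrite inversion-as-less z p p | inversion-as-less z p q | inversion-as-less z q p | inversion-as-less z q q
            | less-no {u = p} {p} (FP.<-irrefl refl) | less-no {u = q} {q} (FP.<-irrefl refl)
            | less-yes p<q | less-no (FP.<-asym p<q)
      = trans (ℕP.+-identityʳ _) (trans (ℕP.+-identityʳ _) (ℕP.+-identityʳ _))

    len-split : ∀ z → len z ≡ less (z q) (z p) + (sumExcept p q (cross z) + rest z)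
    len-split z = begin
      len z                              ≡⟨ len-as-sum z ⟩
      sum (λ a → sum (inversion z a))    ≡⟨ sum²-erase₂ (inversion z) (FP.<⇒≢ p<q) ⟩
      _                                  ≡⟨ cong (_+ (sumExcept p q (cross z) + rest z)) (pair z) ⟩
      less (z q) (z p) + (sumExcept p q (cross z) + rest z) ∎
      where open ≡-Reasoning

    cross-x : ∀ k → cross x k ≡ crossTerm p q k (x p) (x q) (x k)
    cross-x k rewrite inversion-as-less x p k | inversion-as-less x q k
                    | inversion-as-less x k p | inversion-as-less x k q = refl

    cross-y : ∀ k → k ≢ p → k ≢ q → cross y k ≡ crossTerm p q k (x q) (x p) (x k)
    cross-y k k≢p k≢q
      rewrite inversion-as-less y p k | inversion-as-less y q k
            | inversion-as-less y k p | inversion-as-less y k q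
            | transp-at₁ p q | transp-at₂ p q | transp-fix k≢p k≢q = refl

    cross-x≤cross-y : ∀ k → k ≢ p → k ≢ q → ¬ (p < k × k < q) ⊎ x p < x q → cross x k ℕ.≤ cross y k
    cross-x≤cross-y k k≢p k≢q h =
      subst₂ ℕ._≤_ (sym (cross-x k)) (sym (cross-y k k≢p k≢q)) (crossTerm-swap-≤ (x p) (x q) (x k) p<q k≢p k≢q h)

    cross-y≤cross-x : ∀ k → k ≢ p → k ≢ q → ¬ (p < k × k < q) → cross y k ℕ.≤ cross x k
    cross-y≤cross-x k k≢p k≢q h =
      subst₂ ℕ._≤_ (sym (cross-y k k≢p k≢q)) (sym (cross-x k)) (crossTerm-swap-≤ (x q) (x p) (x k) p<q k≢p k≢q (inj₁ h))

    rest-y : rest y ≡ rest x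
    rest-y = sumExcept-cong (λ a a≢p a≢q → sumExcept-cong (λ b b≢p b≢q →
      cong₂ (λ u v → 𝟙 ((a <? b) ×-dec (u <? v))) (cong x (transp-fix b≢p b≢q)) (cong x (transp-fix a≢p a≢q))))

    pair-y : less (y q) (y p) ≡ less (x p) (x q)
    pair-y = cong₂ less (cong x (transp-at₂ p q)) (cong x (transp-at₁ p q))

  len-swap-ascent : x p < x q → len x ℕ.< len (x ∘ transp p q)
  len-swap-ascent ascent = begin-strict
    len x                                            ≡⟨ len-split x ⟩
    less (x q) (x p) + (sumExcept p q (cross x) + rest x)
      ≡⟨ cong (_+ (sumExcept p q (cross x) + rest x)) (less-no (FP.<-asym ascent)) ⟩
    sumExcept p q (cross x) + rest x
      <⟨ s≤s (ℕP.+-mono-≤ (sumExcept-mono (λ k k≢p k≢q → cross-x≤cross-y k k≢p k≢q (inj₂ ascent)))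
                          (ℕP.≤-reflexive (sym rest-y))) ⟩
    1 + (sumExcept p q (cross y) + rest y)
      ≡⟨ cong (_+ (sumExcept p q (cross y) + rest y)) (trans pair-y (less-yes ascent)) ⟨
    less (y q) (y p) + (sumExcept p q (cross y) + rest y) ≡⟨ len-split y ⟨
    len y                                            ∎
    where open ℕP.≤-Reasoning

  len-swap-adjacent : toℕ q ≡ suc (toℕ p) → len (x ∘ transp p q) + less (x q) (x p) ≡ len x + less (x p) (x q)
  len-swap-adjacent adjacent = begin
    len y + less (x q) (x p)
      ≡⟨ cong (_+ less (x q) (x p)) (trans (len-split y) (cong (_+ (sumExcept p q (cross y) + rest y)) pair-y)) ⟩
    less (x p) (x q) + (sumExcept p q (cross y) + rest y) + less (x q) (x p)
      ≡⟨ cong (λ s → less (x p) (x q) + s + less (x q) (x p)) (cong₂ _+_ (sumExcept-cong cross-y≡cross-x) rest-y) ⟩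
    less (x p) (x q) + (sumExcept p q (cross x) + rest x) + less (x q) (x p)
      ≡⟨ swap-outer (less (x p) (x q)) _ (less (x q) (x p)) ⟩
    less (x q) (x p) + (sumExcept p q (cross x) + rest x) + less (x p) (x q)
      ≡⟨ cong (_+ less (x p) (x q)) (len-split x) ⟨
    len x + less (x p) (x q) ∎
    where
      open ≡-Reasoning
      nothing-between : ∀ {k} → ¬ (p < k × k < q)
      nothing-between (p<k , k<q) = ℕP.<⇒≱ p<k (ℕP.≤-pred (subst (toℕ _ ℕ.<_) adjacent k<q))
      cross-y≡cross-x : ∀ k → k ≢ p → k ≢ q → cross y k ≡ cross x k
      cross-y≡cross-x k k≢p k≢q = ℕP.≤-antisym (cross-y≤cross-x k k≢p k≢q nothing-between)
                                               (cross-x≤cross-y k k≢p k≢q (inj₁ nothing-between))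
      swap-outer : ∀ a s b → a + s + b ≡ b + s + a
      swap-outer = solve-∀

record Invertible {n} (x : Fun n) : Set where
  field
    inv : Fun n
    inv-x : ∀ i → inv (x i) ≡ i
    x-inv : ∀ v → x (inv v) ≡ v
open Invertible public

invertible⇒injective : ∀ {n} {x : Fun n} → Invertible x → Injective _≡_ _≡_ x
invertible⇒injective Ix {i} {j} xi≡xj = trans (sym (inv-x Ix i)) (trans (cong (inv Ix) xi≡xj) (inv-x Ix j))

id-invertible : ∀ {n} → Invertible {n} id
id-invertible = record { inv = id ; inv-x = λ _ → refl ; x-inv = λ _ → refl }

∘-invertible : ∀ {n} {x y : Fun n} → Invertible x → Invertible y → Invertible (x ∘ y)
∘-invertible {x = x} {y} Ix Iy = record
  { inv = inv Iy ∘ inv Ix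
  ; inv-x = λ i → trans (cong (inv Iy) (inv-x Ix (y i))) (inv-x Iy i)
  ; x-inv = λ v → trans (cong x (x-inv Iy (inv Ix v))) (x-inv Ix v)
  }

transp-invertible : ∀ {n} (a b : Fin n) → Invertible (transp a b)
transp-invertible a b = record { inv = transp a b ; inv-x = transp-involutive a b ; x-inv = transp-involutive a b }

≈-invertible : ∀ {n} {x y : Fun n} → x ≈ y → Invertible x → Invertible y
≈-invertible x≈y Ix = record
  { inv = inv Ix
  ; inv-x = λ i → trans (cong (inv Ix) (sym (x≈y i))) (inv-x Ix i)
  ; x-inv = λ v → trans (sym (x≈y (inv Ix v))) (x-inv Ix v)
  }

injective⇒surjective : ∀ {n} (x : Fun n) → Injective _≡_ _≡_ x → ∀ v → ∃ λ i → x i ≡ v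
injective⇒surjective {suc m} x x-inj v with FP.any? (λ i → x i ≟ v)
... | yes hit = hit
... | no miss with FP.pigeonhole (ℕP.n<1+n m) (λ k → F.punchOut {i = v} (miss ∘ (k ,_) ∘ sym))
...   | i , j , i<j , same =
  ⊥-elim (FP.<⇒≢ i<j (x-inj (FP.punchOut-injective (miss ∘ (i ,_) ∘ sym) (miss ∘ (j ,_) ∘ sym) same)))

injective⇒invertible : ∀ {n} (x : Fun n) → Injective _≡_ _≡_ x → Invertible x
injective⇒invertible x x-inj = record
  { inv = λ v → proj₁ (injective⇒surjective x x-inj v)
  ; inv-x = λ i → x-inj (proj₂ (injective⇒surjective x x-inj (x i)))
  ; x-inv = λ v → proj₂ (injective⇒surjective x x-inj v)
  }

transp-values≈transp-positions : ∀ {n} {x : Fun n} → Injective _≡_ _≡_ x → ∀ {p q c d} →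
  x p ≡ c → x q ≡ d → (transp c d ∘ x) ≈ (x ∘ transp p q)
transp-values≈transp-positions {x = x} x-inj {p} {q} {c} {d} xp≡c xq≡d i = go (i ≟ p) (i ≟ q)
  where
    go : Dec (i ≡ p) → Dec (i ≡ q) → transp c d (x i) ≡ x (transp p q i)
    go (yes refl) _ = begin
      transp c d (x i) ≡⟨ cong (transp c d) xp≡c ⟩
      transp c d c     ≡⟨ transp-at₁ c d ⟩
      d                ≡⟨ xq≡d ⟨
      x q              ≡⟨ cong x (transp-at₁ i q) ⟨
      x (transp i q i) ∎
      where open ≡-Reasoning
    go (no _) (yes refl) = begin
      transp c d (x i) ≡⟨ cong (transp c d) xq≡d ⟩
      transp c d d     ≡⟨ transp-at₂ c d ⟩
      c                ≡⟨ xp≡c ⟨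
      x p              ≡⟨ cong x (transp-at₂ p i) ⟨
      x (transp p i i) ∎
      where open ≡-Reasoning
    go (no i≢p) (no i≢q) =
      trans (transp-fix (i≢p ∘ x-inj ∘ (λ e → trans e (sym xp≡c))) (i≢q ∘ x-inj ∘ (λ e → trans e (sym xq≡d))))
            (cong x (sym (transp-fix i≢p i≢q)))

len-swap-values-ascent : ∀ {n} {x : Fun n} → Injective _≡_ _≡_ x → ∀ {p q c d} → p < q →
  x p ≡ c → x q ≡ d → c < d → len x ℕ.< len (transp c d ∘ x)
len-swap-values-ascent {x = x} x-inj {p} {q} p<q xp≡c xq≡d c<d
  rewrite len-cong (transp-values≈transp-positions x-inj xp≡c xq≡d) =
  len-swap-ascent x p<q (subst₂ _<_ (sym xp≡c) (sym xq≡d) c<d)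

InTL-cong : ∀ {n} {x y : Fun n} → x ≈ y → ∀ {c d} → InTL x c d → InTL y c d
InTL-cong x≈y {c} {d} = subst₂ ℕ._<_ (len-cong (cong (transp c d) ∘ x≈y)) (len-cong x≈y)

module _ {n} {x : Fun n} (Ix : Invertible x) {c d : Fin n} (c<d : c < d) where

  inverted⇒InTL : inv Ix d < inv Ix c → InTL x c d
  inverted⇒InTL inverted =
    subst (len (transp c d ∘ x) ℕ.<_) (len-cong (transp-involutive c d ∘ x))
      (len-swap-values-ascent (invertible⇒injective (∘-invertible (transp-invertible c d) Ix))
        inverted (moved d c (transp-at₂ c d)) (moved c d (transp-at₁ c d)) c<d)
    where
      moved : ∀ u v → transp c d u ≡ v → transp c d (x (inv Ix u)) ≡ v
      moved u v eq = trans (cong (transp c d) (x-inv Ix u)) eq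

  private
    inv-distinct : inv Ix c ≢ inv Ix d
    inv-distinct eq = FP.<⇒≢ c<d (trans (sym (x-inv Ix c)) (trans (cong x eq) (x-inv Ix d)))

  InTL⇒inverted : InTL x c d → inv Ix d < inv Ix c
  InTL⇒inverted descent with FP.<-cmp (inv Ix c) (inv Ix d)
  ... | tri> _ _ inverted = inverted
  ... | tri≈ _ eq _ = ⊥-elim (inv-distinct eq)
  ... | tri< ordered _ _ = ⊥-elim (ℕP.<-asym descent
          (len-swap-values-ascent (invertible⇒injective Ix) ordered (x-inv Ix c) (x-inv Ix d) c<d))

  ascent⇒ordered : len x ℕ.< len (transp c d ∘ x) → inv Ix c < inv Ix d
  ascent⇒ordered ascent with FP.<-cmp (inv Ix c) (inv Ix d)
  ... | tri< ordered _ _ = ordered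
  ... | tri≈ _ eq _ = ⊥-elim (inv-distinct eq)
  ... | tri> _ _ inverted = ⊥-elim (ℕP.<-asym ascent (inverted⇒InTL inverted))

  ordered⇒¬InTL : inv Ix c < inv Ix d → ¬ InTL x c d
  ordered⇒¬InTL ordered descent = FP.<-asym ordered (InTL⇒inverted descent)

  ¬InTL⇒ordered : ¬ InTL x c d → inv Ix c < inv Ix d
  ¬InTL⇒ordered ¬descent with FP.<-cmp (inv Ix c) (inv Ix d)
  ... | tri< ordered _ _ = ordered
  ... | tri≈ _ eq _ = ⊥-elim (inv-distinct eq)
  ... | tri> _ _ inverted = ⊥-elim (¬descent (inverted⇒InTL inverted))

-- Words in the simple reflections and the right weak order

open SimpleRefl

simple : ∀ {n} → SimpleRefl n → Fun n
simple s = transp (i s) (j s)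

Reduced : ∀ {n} → List (SimpleRefl n) → Set
Reduced w = length w ≡ len (prod w)

prod-++ : ∀ {n} (u v : List (SimpleRefl n)) → prod (u ++ v) ≈ (prod u ∘ prod v)
prod-++ [] v x = refl
prod-++ (s ∷ u) v x = cong (simple s) (prod-++ u v x)

prod-invertible : ∀ {n} (w : List (SimpleRefl n)) → Invertible (prod w)
prod-invertible [] = id-invertible
prod-invertible (s ∷ w) = ∘-invertible (transp-invertible (i s) (j s)) (prod-invertible w)

simple-< : ∀ {n} (s : SimpleRefl n) → i s < j s
simple-< s rewrite adj s = ℕP.n<1+n _

len-∘-simple : ∀ {n} (x : Fun n) (s : SimpleRefl n) →
  len (x ∘ simple s) + less (x (j s)) (x (i s)) ≡ len x + less (x (i s)) (x (j s))
len-∘-simple x s = len-swap-adjacent x (simple-< s) (adj s)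

len-∘-simple-≤ : ∀ {n} (x : Fun n) (s : SimpleRefl n) → len (x ∘ simple s) ℕ.≤ suc (len x)
len-∘-simple-≤ x s = begin
  len (x ∘ simple s)                            ≤⟨ ℕP.m≤m+n _ _ ⟩
  len (x ∘ simple s) + less (x (j s)) (x (i s)) ≡⟨ len-∘-simple x s ⟩
  len x + less (x (i s)) (x (j s))              ≤⟨ ℕP.+-monoʳ-≤ (len x) (𝟙≤1 (x (i s) <? x (j s))) ⟩
  len x + 1                                     ≡⟨ ℕP.+-comm (len x) 1 ⟩
  suc (len x)                                   ∎
  where open ℕP.≤-Reasoning

len-∘-simple-ascent : ∀ {n} (x : Fun n) (s : SimpleRefl n) → x (i s) < x (j s) → len (x ∘ simple s) ≡ suc (len x)
len-∘-simple-ascent x s ascent = begin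
  len (x ∘ simple s)                            ≡⟨ ℕP.+-identityʳ _ ⟨
  len (x ∘ simple s) + 0                        ≡⟨ cong (len (x ∘ simple s) +_) (less-no (FP.<-asym ascent)) ⟨
  len (x ∘ simple s) + less (x (j s)) (x (i s)) ≡⟨ len-∘-simple x s ⟩
  len x + less (x (i s)) (x (j s))              ≡⟨ cong (len x +_) (less-yes ascent) ⟩
  len x + 1                                     ≡⟨ ℕP.+-comm (len x) 1 ⟩
  suc (len x)                                   ∎
  where open ≡-Reasoning

len-prod-++-≤ : ∀ {n} (u v : List (SimpleRefl n)) → len (prod (u ++ v)) ℕ.≤ len (prod u) + length v
len-prod-++-≤ u [] rewrite LP.++-identityʳ u = ℕP.m≤m+n _ _
len-prod-++-≤ u (s ∷ v) rewrite sym (LP.∷ʳ-++ u s v) = begin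
  len (prod (u L.∷ʳ s ++ v))        ≤⟨ len-prod-++-≤ (u L.∷ʳ s) v ⟩
  len (prod (u L.∷ʳ s)) + length v  ≡⟨ cong (_+ length v) (len-cong (prod-++ u L.[ s ])) ⟩
  len (prod u ∘ simple s) + length v ≤⟨ ℕP.+-monoˡ-≤ (length v) (len-∘-simple-≤ (prod u) s) ⟩
  suc (len (prod u)) + length v     ≡⟨ ℕP.+-suc (len (prod u)) (length v) ⟨
  len (prod u) + suc (length v)     ∎
  where open ℕP.≤-Reasoning

len-id : ∀ {n} → len {n} id ≡ 0
len-id {n} = begin
  len {n} id                              ≡⟨ len-as-sum {n} id ⟩
  sum {n} (λ i → sum (inversion id i))    ≡⟨ sum-cong-≗ {n} (λ i → trans (sum-cong-≗ {n} (no-inversion i)) (sum-replicate-zero n)) ⟩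
  sum {n} (λ _ → 0)                       ≡⟨ sum-replicate-zero n ⟩
  0                                       ∎
  where
    open ≡-Reasoning
    no-inversion : ∀ (i j : Fin n) → inversion id i j ≡ 0
    no-inversion i j = 𝟙-no ((i <? j) ×-dec (j <? i)) (λ (i<j , j<i) → FP.<-asym i<j j<i)

prefix-reduced : ∀ {n} (u v : List (SimpleRefl n)) → Reduced (u ++ v) → Reduced u
prefix-reduced {n} u v reduced = ℕP.≤-antisym (ℕP.+-cancelʳ-≤ (length v) _ _ long) short
  where
    open ℕP.≤-Reasoning
    long : length u + length v ℕ.≤ len (prod u) + length v
    long = begin
      length u + length v    ≡⟨ LP.length-++ u ⟨
      length (u ++ v)        ≡⟨ reduced ⟩
      len (prod (u ++ v))    ≤⟨ len-prod-++-≤ u v ⟩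
      len (prod u) + length v ∎
    short : len (prod u) ℕ.≤ length u
    short = begin
      len (prod ([] ++ u))   ≤⟨ len-prod-++-≤ [] u ⟩
      len {n} id + length u  ≡⟨ cong (_+ length u) (len-id {n}) ⟩
      length u               ∎

reduced-snoc⇒ascent : ∀ {n} (u : List (SimpleRefl n)) (s : SimpleRefl n) →
  Reduced u → Reduced (u L.∷ʳ s) → prod u (i s) < prod u (j s)
reduced-snoc⇒ascent u s reduced-u reduced-us with prod u (i s) <? prod u (j s)
... | yes ascent = ascent
... | no ¬ascent = ⊥-elim (ℕP.<⇒≢ (s≤s (ℕP.m≤m+n (len x) _)) (sym shrinks))
  where
    open ≡-Reasoning
    x = prod u
    longer : len (x ∘ simple s) ≡ suc (len x)
    longer = begin
      len (x ∘ simple s)        ≡⟨ len-cong (prod-++ u L.[ s ]) ⟨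
      len (prod (u L.∷ʳ s))     ≡⟨ reduced-us ⟨
      length (u L.∷ʳ s)         ≡⟨ LP.length-++ u ⟩
      length u + 1              ≡⟨ ℕP.+-comm (length u) 1 ⟩
      suc (length u)            ≡⟨ cong suc reduced-u ⟩
      suc (len x)               ∎
    shrinks : suc (len x) + less (x (j s)) (x (i s)) ≡ len x
    shrinks = begin
      suc (len x) + less (x (j s)) (x (i s))        ≡⟨ cong (_+ less (x (j s)) (x (i s))) longer ⟨
      len (x ∘ simple s) + less (x (j s)) (x (i s)) ≡⟨ len-∘-simple x s ⟩
      len x + less (x (i s)) (x (j s))              ≡⟨ cong (len x +_) (less-no ¬ascent) ⟩
      len x + 0                                     ≡⟨ ℕP.+-identityʳ (len x) ⟩
      len x                                         ∎

simple-monotone : ∀ {n} (s : SimpleRefl n) {p q : Fin n} → p < q → ¬ (p ≡ i s × q ≡ j s) → simple s p < simple s q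
simple-monotone s {p} {q} p<q not-the-pair = go (p ≟ i s) (p ≟ j s) (q ≟ i s) (q ≟ j s)
  where
    go : Dec (p ≡ i s) → Dec (p ≡ j s) → Dec (q ≡ i s) → Dec (q ≡ j s) → simple s p < simple s q
    go (yes refl) _ (yes refl) _ = ⊥-elim (FP.<-irrefl refl p<q)
    go (yes refl) _ (no _) (yes q≡j) = ⊥-elim (not-the-pair (refl , q≡j))
    go (yes refl) _ (no q≢i) (no q≢j) rewrite transp-at₁ p (j s) | transp-fix q≢i q≢j =
      ℕP.≤∧≢⇒< (subst (ℕ._≤ toℕ q) (sym (adj s)) p<q) (q≢j ∘ FP.toℕ-injective ∘ sym)
    go (no _) (yes refl) (yes refl) _ = ⊥-elim (ℕP.<-asym p<q (simple-< s))
    go (no _) (yes refl) (no _) (yes refl) = ⊥-elim (FP.<-irrefl refl p<q)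
    go (no _) (yes refl) (no q≢i) (no q≢j) rewrite transp-at₂ (i s) p | transp-fix q≢i q≢j =
      ℕP.<-trans (simple-< s) p<q
    go (no p≢i) (no p≢j) (yes refl) _ rewrite transp-at₁ q (j s) | transp-fix p≢i p≢j =
      ℕP.<-trans p<q (simple-< s)
    go (no p≢i) (no p≢j) (no _) (yes refl) rewrite transp-at₂ (i s) q | transp-fix p≢i p≢j =
      ℕP.≤∧≢⇒< (ℕP.≤-pred (subst (toℕ p ℕ.<_) (adj s) p<q)) (p≢i ∘ FP.toℕ-injective)
    go (no p≢i) (no p≢j) (no q≢i) (no q≢j) rewrite transp-fix p≢i p≢j | transp-fix q≢i q≢j = p<q

InTL-∘-ascent : ∀ {n} {x : Fun n} (Ix : Invertible x) (s : SimpleRefl n) → x (i s) < x (j s) →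
  ∀ {c d} → c < d → InTL x c d → InTL (x ∘ simple s) c d
InTL-∘-ascent {x = x} Ix s ascent {c} {d} c<d descent =
  inverted⇒InTL (∘-invertible Ix (transp-invertible (i s) (j s))) c<d
    (simple-monotone s (InTL⇒inverted Ix c<d descent) not-the-pair)
  where
    not-the-pair : ¬ (inv Ix d ≡ i s × inv Ix c ≡ j s)
    not-the-pair (d-at-i , c-at-j) = FP.<-asym c<d
      (subst₂ _<_ (trans (cong x (sym d-at-i)) (x-inv Ix d)) (trans (cong x (sym c-at-j)) (x-inv Ix c)) ascent)

InTL-prefix : ∀ {n} (u v : List (SimpleRefl n)) → Reduced (u ++ v) →
  ∀ {c d} → c < d → InTL (prod u) c d → InTL (prod (u ++ v)) c d
InTL-prefix u [] _ c<d descent rewrite LP.++-identityʳ u = descent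
InTL-prefix u (s ∷ v) reduced {c} {d} c<d descent =
  subst (λ w → InTL (prod w) c d) (LP.∷ʳ-++ u s v) (InTL-prefix (u L.∷ʳ s) v reduced′ c<d descent′)
  where
    reduced′ : Reduced (u L.∷ʳ s ++ v)
    reduced′ = subst Reduced (sym (LP.∷ʳ-++ u s v)) reduced
    ascent : prod u (i s) < prod u (j s)
    ascent = reduced-snoc⇒ascent u s (prefix-reduced u (s ∷ v) reduced) (prefix-reduced (u L.∷ʳ s) v reduced′)
    descent′ : InTL (prod (u L.∷ʳ s)) c d
    descent′ = InTL-cong (sym ∘ prod-++ u L.[ s ]) (InTL-∘-ascent (prod-invertible u) s ascent c<d descent)

≤R⇒invertible : ∀ {n} {σ ρ : Fun n} → σ ≤R ρ → Invertible ρ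
≤R⇒invertible (u , v , _ , _ , uv≈ρ , _) = ≈-invertible uv≈ρ (prod-invertible (u ++ v))

_⊆TL_ : ∀ {n} → Fun n → Fun n → Set
σ ⊆TL π = ∀ {c d} → c < d → InTL σ c d → InTL π c d

≤R⇒⊆TL : ∀ {n} {σ ρ : Fun n} → σ ≤R ρ → σ ⊆TL ρ
≤R⇒⊆TL (u , v , u≈σ , _ , uv≈ρ , reduced) c<d descent =
  InTL-cong uv≈ρ (InTL-prefix u v (trans reduced (sym (len-cong uv≈ρ))) c<d (InTL-cong (sym ∘ u≈σ) descent))

InTL? : ∀ {n} (w : Fun n) (c d : Fin n) → Dec (InTL w c d)
InTL? w c d = len (transp c d ∘ w) ℕ.<? len w

⊆TL-∘-simple : ∀ {n} {σ π : Fun n} (Iσ : Invertible σ) (s : SimpleRefl n) →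
  σ ⊆TL π → InTL π (σ (i s)) (σ (j s)) → (σ ∘ simple s) ⊆TL π
⊆TL-∘-simple {σ = σ} {π} Iσ s σ⊆π new {c} {d} c<d descent = go (t (inv Iσ d) ≟ i s) (t (inv Iσ c) ≟ j s)
  where
    t = simple s
    inverted : t (inv Iσ d) < t (inv Iσ c)
    inverted = InTL⇒inverted (∘-invertible Iσ (transp-invertible (i s) (j s))) c<d descent
    value-at : ∀ {u k} → t (inv Iσ u) ≡ k → σ (t k) ≡ u
    value-at {u} eq = trans (cong (σ ∘ t) (sym eq)) (trans (cong σ (transp-involutive (i s) (j s) _)) (x-inv Iσ u))
    old : ¬ (t (inv Iσ d) ≡ i s × t (inv Iσ c) ≡ j s) → InTL π c d
    old not-the-pair = σ⊆π c<d (inverted⇒InTL Iσ c<d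
      (subst₂ _<_ (transp-involutive (i s) (j s) _) (transp-involutive (i s) (j s) _)
        (simple-monotone s inverted not-the-pair)))
    go : Dec (t (inv Iσ d) ≡ i s) → Dec (t (inv Iσ c) ≡ j s) → InTL π c d
    go (yes d-at-i) (yes c-at-j) =
      subst₂ (InTL π) (trans (cong σ (sym (transp-at₂ (i s) (j s)))) (value-at c-at-j))
                      (trans (cong σ (sym (transp-at₁ (i s) (j s)))) (value-at d-at-i)) new
    go (no ¬d-at-i) _ = old (¬d-at-i ∘ proj₁)
    go (yes _) (no ¬c-at-j) = old (¬c-at-j ∘ proj₂)

adjacent-increasing⇒≈id : ∀ {n} (f : Fun n) → (∀ a b → toℕ b ≡ suc (toℕ a) → f a < f b) → f ≈ id
adjacent-increasing⇒≈id {n} f increasing i =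
  FP.toℕ-injective (ℕP.≤-antisym (at-most _ i (ℕP.m+[n∸m]≡n (FP.toℕ<n i))) (at-least _ i refl))
  where
    at-least : ∀ m (i : Fin n) → toℕ i ≡ m → m ℕ.≤ toℕ (f i)
    at-least zero i _ = z≤n
    at-least (suc m) i i≡1+m =
      ℕP.≤-trans (s≤s (at-least m h (FP.toℕ-fromℕ< m<n))) (increasing h i (trans i≡1+m (cong suc (sym (FP.toℕ-fromℕ< m<n)))))
      where
        m<n : m ℕ.< n
        m<n = ℕP.<-trans (ℕP.n<1+n m) (subst (ℕ._< n) i≡1+m (FP.toℕ<n i))
        h = F.fromℕ< m<n
    at-most : ∀ m (i : Fin n) → suc (toℕ i) + m ≡ n → toℕ (f i) ℕ.≤ toℕ i
    at-most zero i i+1≡n = ℕP.≤-pred (subst (toℕ (f i) ℕ.<_) (sym (trans (sym (ℕP.+-identityʳ _)) i+1≡n)) (FP.toℕ<n (f i)))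
    at-most (suc m) i i+2+m≡n =
      ℕP.≤-pred (ℕP.<-≤-trans (increasing i k (FP.toℕ-fromℕ< i+1<n))
        (subst (toℕ (f k) ℕ.≤_) (FP.toℕ-fromℕ< i+1<n) (at-most m k k+1+m≡n)))
      where
        i+1<n : suc (toℕ i) ℕ.< n
        i+1<n = ℕP.m+n≤o⇒m≤o (suc (suc (toℕ i))) (ℕP.≤-reflexive (trans (sym (ℕP.+-suc (suc (toℕ i)) m)) i+2+m≡n))
        k = F.fromℕ< i+1<n
        k+1+m≡n : suc (toℕ k) + m ≡ n
        k+1+m≡n rewrite FP.toℕ-fromℕ< i+1<n = trans (sym (ℕP.+-suc (suc (toℕ i)) m)) i+2+m≡n

⊆TL-no-ascent⇒≈ : ∀ {n} {σ π : Fun n} → Invertible σ → Invertible π → σ ⊆TL π →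
  (∀ a b → toℕ b ≡ suc (toℕ a) → σ a < σ b → ¬ InTL π (σ a) (σ b)) → σ ≈ π
⊆TL-no-ascent⇒≈ {σ = σ} {π} Iσ Iπ σ⊆π no-ascent z =
  trans (sym (x-inv Iπ (σ z))) (cong π (adjacent-increasing⇒≈id (inv Iπ ∘ σ) increasing z))
  where
    increasing : ∀ a b → toℕ b ≡ suc (toℕ a) → inv Iπ (σ a) < inv Iπ (σ b)
    increasing a b adjacent with FP.<-cmp (σ a) (σ b)
    ... | tri< ascent _ _ = ¬InTL⇒ordered Iπ ascent (no-ascent a b adjacent ascent)
    ... | tri≈ _ eq _ = ⊥-elim (ℕP.<⇒≢ a<b (cong toℕ (invertible⇒injective Iσ eq)))
      where a<b : a < b
            a<b = subst (toℕ a ℕ.<_) (sym adjacent) (ℕP.n<1+n _)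
    ... | tri> _ _ descent = InTL⇒inverted Iπ descent (σ⊆π descent (inverted⇒InTL Iσ descent
            (subst₂ _<_ (sym (inv-x Iσ a)) (sym (inv-x Iσ b)) (subst (toℕ a ℕ.<_) (sym adjacent) (ℕP.n<1+n _)))))

maxLen : ℕ → ℕ
maxLen n = length (cartesianProduct (L.allFin n) (L.allFin n))

len≤maxLen : ∀ {n} (x : Fun n) → len x ℕ.≤ maxLen n
len≤maxLen {n} x = LP.length-filter _ (cartesianProduct (L.allFin n) (L.allFin n))

-- The fuel bounds the number of simple reflections still to be appended, since every one
-- of them increases the length, which never exceeds maxLen n.
⊆TL⇒suffix : ∀ {n} (fuel : ℕ) {σ π : Fun n} → Invertible σ → Invertible π → σ ⊆TL π →
  maxLen n ℕ.≤ len σ + fuel → ∃ λ v → ((σ ∘ prod v) ≈ π) × (len σ + length v ≡ len π)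
⊆TL⇒suffix {n} fuel {σ} {π} Iσ Iπ σ⊆π enough
  with FP.any? (λ a → FP.any? (λ b → (toℕ b ℕ.≟ suc (toℕ a)) ×-dec ((σ a <? σ b) ×-dec InTL? π (σ a) (σ b))))
... | no none = [] , σ≈π , trans (ℕP.+-identityʳ (len σ)) (len-cong σ≈π)
  where
    σ≈π : σ ≈ π
    σ≈π = ⊆TL-no-ascent⇒≈ Iσ Iπ σ⊆π (λ a b adjacent ascent new → none (a , b , adjacent , ascent , new))
... | yes (a , b , adjacent , ascent , new) = extend fuel enough
  where
    s : SimpleRefl n
    s = record { i = a ; j = b ; adj = adjacent }
    longer : len (σ ∘ simple s) ≡ suc (len σ)
    longer = len-∘-simple-ascent σ s ascent
    extend : ∀ fuel → maxLen n ℕ.≤ len σ + fuel → ∃ λ v → ((σ ∘ prod v) ≈ π) × (len σ + length v ≡ len π)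
    extend zero enough = ⊥-elim (ℕP.<-irrefl refl (begin-strict
      len (σ ∘ simple s)  ≤⟨ len≤maxLen (σ ∘ simple s) ⟩
      maxLen n            ≤⟨ enough ⟩
      len σ + 0           ≡⟨ ℕP.+-identityʳ (len σ) ⟩
      len σ               <⟨ ℕP.n<1+n (len σ) ⟩
      suc (len σ)         ≡⟨ longer ⟨
      len (σ ∘ simple s)  ∎))
      where open ℕP.≤-Reasoning
    extend (suc fuel) enough
      with ⊆TL⇒suffix fuel (∘-invertible Iσ (transp-invertible a b)) Iπ (⊆TL-∘-simple Iσ s σ⊆π new)
             (subst (maxLen n ℕ.≤_) (trans (ℕP.+-suc (len σ) fuel) (cong (_+ fuel) (sym longer))) enough)
    ... | v , σsv≈π , len-σsv≡len-π =
      s ∷ v , σsv≈π , trans (ℕP.+-suc (len σ) (length v)) (trans (cong (_+ length v) (sym longer)) len-σsv≡len-π)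

reduced-word : ∀ {n} {σ : Fun n} → Invertible σ → ∃ λ u → (prod u ≈ σ) × (length u ≡ len σ)
reduced-word {n} {σ} Iσ with ⊆TL⇒suffix (maxLen n) id-invertible Iσ id⊆TLσ (ℕP.m≤n+m _ _)
  where
    id⊆TLσ : id ⊆TL σ
    id⊆TLσ _ shorter with () ← ℕP.≤-trans shorter (ℕP.≤-reflexive (len-id {n}))
... | u , u≈σ , len-u≡len-σ = u , u≈σ , trans (cong (_+ length u) (sym (len-id {n}))) len-u≡len-σ

⊆TL⇒≤R : ∀ {n} {σ π : Fun n} → Invertible σ → Invertible π → σ ⊆TL π → σ ≤R π
⊆TL⇒≤R {n} {σ} {π} Iσ Iπ σ⊆π with reduced-word Iσ | ⊆TL⇒suffix (maxLen n) Iσ Iπ σ⊆π (ℕP.m≤n+m _ _)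
... | u , u≈σ , reduced-u | v , σv≈π , len-σv≡len-π =
  u , v , u≈σ , reduced-u , (λ z → trans (prod-++ u v z) (trans (u≈σ (prod v z)) (σv≈π z))) ,
  trans (LP.length-++ u) (trans (cong (_+ length v) reduced-u) len-σv≡len-π)

-- Bruhat paths

TL∪ : ∀ {n} → Fun n → Fun n → Fin n → Fin n → Set
TL∪ σ τ c d = InTL σ c d ⊎ InTL τ c d

TL∪? : ∀ {n} (σ τ : Fun n) c d → Dec (TL∪ σ τ c d)
TL∪? σ τ c d = InTL? σ c d ⊎-dec InTL? τ c d

data Edge {n} (L : Fin n → Fin n → Set) : Fun n → Fun n → Set where
  edge : ∀ {x c d} → c < d → L c d → len x ℕ.< len (transp c d ∘ x) → Edge L x (transp c d ∘ x)

Edge-map : ∀ {n} {L L′ : Fin n → Fin n → Set} → (∀ {c d} → L c d → L′ c d) → ∀ {x y} → Edge L x y → Edge L′ x y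
Edge-map f (edge c<d l ascent) = edge c<d (f l) ascent

BruhatReach-≈ : ∀ {n} {σ τ y y′ : Fun n} → y ≈ y′ → BruhatReach σ τ y → BruhatReach σ τ y′
BruhatReach-≈ y≈y′ (start y≈id) = start (λ k → trans (sym (y≈y′ k)) (y≈id k))
BruhatReach-≈ y≈y′ (step a b a<b l r ascent y≈) = step a b a<b l r ascent (λ k → trans (sym (y≈y′ k)) (y≈ k))

BruhatReach-along : ∀ {n} {σ τ x y : Fun n} → BruhatReach σ τ x → Star (Edge (TL∪ σ τ)) x y → BruhatReach σ τ y
BruhatReach-along r ε = r
BruhatReach-along r (edge c<d l ascent ◅ path) = BruhatReach-along (step _ _ c<d l r ascent (λ _ → refl)) path

BruhatReach-invertible : ∀ {n} {σ τ y : Fun n} → BruhatReach σ τ y → Invertible y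
BruhatReach-invertible (start y≈id) = ≈-invertible (sym ∘ y≈id) id-invertible
BruhatReach-invertible (step a b _ _ r _ y≈) = ≈-invertible (sym ∘ y≈) (∘-invertible (transp-invertible a b) (BruhatReach-invertible r))

Bounded : ∀ {n} → (Fin n → Fin n → Set) → Fin n → Fin n → Fin n → Set
Bounded L w c d = L c d × d ≤ w

FixesAbove : ∀ {n} → Fin n → Fun n → Set
FixesAbove w x = ∀ i → w < i → x i ≡ i

module _ {n} {L : Fin n → Fin n → Set} {w v : Fin n} (w<v : w < v) where

  private
    g : Fun n
    g = transp w v

  conjugate-edge : ∀ {x y} → Invertible x → FixesAbove w x → Edge (Bounded L w) x y →
    Edge (Bounded L w) (x ∘ g) (y ∘ g)
  conjugate-edge {x} Ix fixes (edge {c = c} {d} c<d (l , d≤w) ascent) =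
    edge c<d (l , d≤w) (len-swap-values-ascent (invertible⇒injective (∘-invertible Ix (transp-invertible w v)))
      (subst (_< g q) (sym gp≡p) p<gq) (at c) (at d) c<d)
    where
      p = inv Ix c
      q = inv Ix d
      p<q : p < q
      p<q = ascent⇒ordered Ix c<d ascent
      q≤w : q ≤ w
      q≤w = ℕP.≮⇒≥ (λ w<q → ℕP.<⇒≱ w<q (subst (_≤ w) (trans (sym (x-inv Ix d)) (fixes q w<q)) d≤w))
      p<w : p < w
      p<w = ℕP.<-≤-trans p<q q≤w
      gp≡p : g p ≡ p
      gp≡p = transp-fix (FP.<⇒≢ p<w) (FP.<⇒≢ (ℕP.<-trans p<w w<v))
      p<gq : p < g q
      p<gq = go (q ≟ w)
        where
          go : Dec (q ≡ w) → p < g q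
          go (yes q≡w) = subst (p <_) (sym (trans (cong g q≡w) (transp-at₁ w v))) (ℕP.<-trans p<w w<v)
          go (no q≢w) = subst (p <_) (sym (transp-fix q≢w (FP.<⇒≢ (ℕP.≤-<-trans q≤w w<v)))) p<q
      at : ∀ u → x (g (g (inv Ix u))) ≡ u
      at u = trans (cong x (transp-involutive w v (inv Ix u))) (x-inv Ix u)

  conjugate-path : ∀ {x y} → Invertible x → FixesAbove w x → Star (Edge (Bounded L w)) x y →
    Star (Edge (Bounded L w)) (x ∘ g) (y ∘ g)
  conjugate-path Ix fixes ε = ε
  conjugate-path {x} Ix fixes (e@(edge {c = c} {d} c<d (_ , d≤w) _) ◅ path) =
    conjugate-edge Ix fixes e ◅ conjugate-path (∘-invertible (transp-invertible c d) Ix) fixes′ path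
    where
      fixes′ : FixesAbove w (transp c d ∘ x)
      fixes′ i w<i rewrite fixes i w<i =
        transp-fix (λ i≡c → ℕP.<-asym (ℕP.<-≤-trans c<d d≤w) (subst (w <_) i≡c w<i))
                   (λ i≡d → ℕP.<⇒≱ (subst (w <_) i≡d w<i) d≤w)

data Chain {n} (L : Fin n → Fin n → Set) (a : Fin n) : Fin n → Set where
  base : Chain L a a
  ext : ∀ {w v} → Chain L a w → w < v → L w v → Chain L a v

Chain-≤ : ∀ {n} {L : Fin n → Fin n → Set} {a v : Fin n} → Chain L a v → a ≤ v
Chain-≤ base = ℕP.≤-refl
Chain-≤ (ext chain w<v _) = ℕP.≤-trans (Chain-≤ chain) (ℕP.<⇒≤ w<v)

-- With w the last but one element of the chain, (a v) = (w v) (a w) (w v) gives the path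
-- (w v), then the path to (a w) conjugated by (w v), then (w v) again.
chain⇒path : ∀ {n} {L : Fin n → Fin n → Set} {a v : Fin n} → Chain L a v → a < v →
  ∃ λ y → (y ≈ transp a v) × Star (Edge (Bounded L v)) id y
chain⇒path base a<a = ⊥-elim (FP.<-irrefl refl a<a)
chain⇒path {n} {L = L} {a} (ext {w} {v} chain w<v l) a<v = go (w ≟ a)
  where
    g : Fun n
    g = transp w v
    first-edge : Edge (Bounded L v) id (g ∘ id)
    first-edge = edge w<v (l , ℕP.≤-refl) (len-swap-values-ascent (λ eq → eq) w<v refl refl w<v)
    go : Dec (w ≡ a) → ∃ λ y → (y ≈ transp a v) × Star (Edge (Bounded L v)) id y
    go (yes refl) = g ∘ id , (λ _ → refl) , first-edge ◅ ε
    go (no w≢a) = conjugated (chain⇒path chain a<w)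
      where
        a<w : a < w
        a<w = FP.≤∧≢⇒< (Chain-≤ chain) (w≢a ∘ sym)
        a≢w = FP.<⇒≢ a<w
        a≢v = FP.<⇒≢ a<v
        w≢v = FP.<⇒≢ w<v
        weaken : ∀ {x z} → Edge (Bounded L w) x z → Edge (Bounded L v) x z
        weaken = Edge-map (λ (l , d≤w) → l , ℕP.≤-trans d≤w (ℕP.<⇒≤ w<v))
        conjugated : (∃ λ y → (y ≈ transp a w) × Star (Edge (Bounded L w)) id y) →
          ∃ λ y → (y ≈ transp a v) × Star (Edge (Bounded L v)) id y
        conjugated (y , y≈ , path) = g ∘ (y ∘ g) , conjugate ,
          first-edge ◅ (Star.map weaken (conjugate-path w<v id-invertible (λ _ _ → refl) path) ◅◅ (last-edge ◅ ε))
          where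
            last-edge : Edge (Bounded L v) (y ∘ g) (g ∘ (y ∘ g))
            last-edge = edge w<v (l , ℕP.≤-refl) (len-swap-values-ascent
              (invertible⇒injective (∘-invertible (≈-invertible (sym ∘ y≈) (transp-invertible a w)) (transp-invertible w v)))
              a<w
              (trans (cong y (transp-fix a≢w a≢v)) (trans (y≈ a) (transp-at₁ a w)))
              (trans (cong y (transp-at₁ w v)) (trans (y≈ v) (transp-fix (a≢v ∘ sym) (w≢v ∘ sym))))
              w<v)
            conjugate : (g ∘ (y ∘ g)) ≈ transp a v
            conjugate x = trans (cong g (y≈ (g x))) (transp-conjugate a≢w a≢v w≢v x)

module _ {n} (key : Fin n → ℕ) (key-injective : Injective _≡_ _≡_ key) where

  private
    rank : Fin n → ℕ
    rank v = sum (λ w → 𝟙 (key v ℕ.<? key w))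

    rank-< : ∀ {v w} → key v ℕ.< key w → rank w ℕ.< rank v
    rank-< {v} {w} v<w = sum-mono-< w
      (λ u → 𝟙-mono (key w ℕ.<? key u) (key v ℕ.<? key u) (ℕP.<-trans v<w))
      (subst₂ ℕ._<_ (sym (𝟙-no (key w ℕ.<? key w) (ℕP.<-irrefl refl))) (sym (𝟙-yes (key v ℕ.<? key w) v<w)) (s≤s z≤n))

    rank<n : ∀ v → rank v ℕ.< n
    rank<n v = subst (rank v ℕ.<_) (sum-ones n) (sum-mono-< v (λ u → 𝟙≤1 (key v ℕ.<? key u))
      (subst (ℕ._< 1) (sym (𝟙-no (key v ℕ.<? key v) (ℕP.<-irrefl refl))) (s≤s z≤n)))

    position : Fun n
    position v = F.fromℕ< (rank<n v)

    position-< : ∀ {v w} → key v ℕ.< key w → position w < position v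
    position-< {v} {w} v<w =
      subst₂ ℕ._<_ (sym (FP.toℕ-fromℕ< (rank<n w))) (sym (FP.toℕ-fromℕ< (rank<n v))) (rank-< v<w)

    position-injective : Injective _≡_ _≡_ position
    position-injective {v} {w} eq with ℕP.<-cmp (key v) (key w)
    ... | tri< v<w _ _ = ⊥-elim (FP.<⇒≢ (position-< v<w) (sym eq))
    ... | tri≈ _ v≡w _ = key-injective v≡w
    ... | tri> _ _ w<v = ⊥-elim (FP.<⇒≢ (position-< w<v) eq)

  sorted-by-key : ∃ λ π → Σ (Invertible π) λ Iπ → ∀ {v w} → key v ℕ.< key w → inv Iπ w < inv Iπ v
  sorted-by-key = inv P , record { inv = position ; inv-x = x-inv P ; x-inv = inv-x P } , position-<
    where P = injective⇒invertible position position-injective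

module _ {n} {L : Fin n → Fin n → Set} (L? : ∀ c d → Dec (L c d)) (a : Fin n) where

  private
    chain-below? : ∀ k v → toℕ v ℕ.< k → Dec (Chain L a v)
    chain-below? (suc k) v v<1+k with v ≟ a
    ... | yes refl = yes base
    ... | no v≢a with FP.any? (λ w → predecessor? w (w <? v))
      where
        predecessor? : ∀ w → Dec (w < v) → Dec (w < v × L w v × Chain L a w)
        predecessor? w (no w≮v) = no (w≮v ∘ proj₁)
        predecessor? w (yes w<v) with L? w v | chain-below? k w (ℕP.<-≤-trans w<v (ℕP.≤-pred v<1+k))
        ... | yes l | yes chain = yes (w<v , l , chain)
        ... | no ¬l | _ = no (¬l ∘ proj₁ ∘ proj₂)
        ... | _ | no ¬chain = no (¬chain ∘ proj₂ ∘ proj₂)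
    ...   | yes (w , w<v , l , chain) = yes (ext chain w<v l)
    ...   | no none = no λ { base → v≢a refl ; (ext {w} chain w<v l) → none (w , w<v , l , chain) }

  chain? : ∀ v → Dec (Chain L a v)
  chain? v = chain-below? (suc (toℕ v)) v ℕP.≤-refl

  private
    bonus : ∀ {v} → Dec (Chain L a v) → ℕ
    bonus (yes _) = n
    bonus (no _) = 0

    key : Fin n → ℕ
    key v = toℕ v + bonus (chain? v)

    below-bonus : ∀ (v : Fin n) m → toℕ v ℕ.< m + n
    below-bonus v m = ℕP.<-≤-trans (FP.toℕ<n v) (ℕP.m≤n+m n m)

    key-injective : Injective _≡_ _≡_ key
    key-injective {v} {w} = go (chain? v) (chain? w)
      where
        go : (dv : Dec (Chain L a v)) (dw : Dec (Chain L a w)) → toℕ v + bonus dv ≡ toℕ w + bonus dw → v ≡ w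
        go (yes _) (yes _) eq = FP.toℕ-injective (ℕP.+-cancelʳ-≡ n _ _ eq)
        go (no _) (no _) eq = FP.toℕ-injective (ℕP.+-cancelʳ-≡ 0 _ _ eq)
        go (yes _) (no _) eq = ⊥-elim (ℕP.<⇒≢ (below-bonus w _) (trans (sym (ℕP.+-identityʳ _)) (sym eq)))
        go (no _) (yes _) eq = ⊥-elim (ℕP.<⇒≢ (below-bonus v _) (trans (sym (ℕP.+-identityʳ _)) eq))

    key-increasing : ∀ {c d} → c < d → L c d → key c ℕ.< key d
    key-increasing {c} {d} c<d l = go (chain? c) (chain? d)
      where
        go : (dc : Dec (Chain L a c)) (dd : Dec (Chain L a d)) → toℕ c + bonus dc ℕ.< toℕ d + bonus dd
        go (yes _) (yes _) = ℕP.+-monoˡ-< n c<d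
        go (yes chain) (no ¬chain) = ⊥-elim (¬chain (ext chain c<d l))
        go (no _) (yes _) = ℕP.<-≤-trans (ℕP.+-monoˡ-< 0 c<d) (ℕP.+-monoʳ-≤ (toℕ d) z≤n)
        go (no _) (no _) = ℕP.+-monoˡ-< 0 c<d

  -- Listing first the values reachable from a by a chain, then the others, each group in
  -- decreasing order, makes every L-pair an inversion but not (a b).
  separating-permutation : ∀ {b} → a < b → ¬ Chain L a b →
    ∃ λ π → Invertible π × (∀ {c d} → c < d → L c d → InTL π c d) × ¬ InTL π a b
  separating-permutation {b} a<b ¬chain with sorted-by-key key key-injective
  ... | π , Iπ , sorted =
    π , Iπ , (λ c<d l → inverted⇒InTL Iπ c<d (sorted (key-increasing c<d l))) , ordered⇒¬InTL Iπ a<b (sorted key-b<key-a)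
    where
      key-b<key-a : key b ℕ.< key a
      key-b<key-a = go (chain? a) (chain? b)
        where
          go : (da : Dec (Chain L a a)) (db : Dec (Chain L a b)) → toℕ b + bonus db ℕ.< toℕ a + bonus da
          go (yes _) (no _) = subst (ℕ._< toℕ a + n) (sym (ℕP.+-identityʳ _)) (below-bonus b (toℕ a))
          go (no ¬base) _ = ⊥-elim (¬base base)
          go _ (yes chain) = ⊥-elim (¬chain chain)

-- A potential that does not increase along Bruhat paths

module _ {n} {X : Fin n → Set} (X? : ∀ v → Dec (X v)) where

  potential : Fun n → ℕ
  potential x = sum (λ i → 𝟙 (X? (x i)) * toℕ i)

  potential-cong : ∀ {x y} → x ≈ y → potential x ≡ potential y
  potential-cong x≈y = sum-cong-≗ (λ i → cong (λ v → 𝟙 (X? v) * toℕ i) (x≈y i))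

  private
    rest : Fin n → Fin n → Fun n → ℕ
    rest p q x = sumExcept p q (λ i → 𝟙 (X? (x i)) * toℕ i)

    potential-split : ∀ x {p q : Fin n} → p ≢ q → potential x ≡ 𝟙 (X? (x p)) * toℕ p + 𝟙 (X? (x q)) * toℕ q + rest p q x
    potential-split x p≢q = sum-erase₂ (λ i → 𝟙 (X? (x i)) * toℕ i) p≢q

    rest-∘-transp : ∀ x {p q : Fin n} → rest p q (x ∘ transp p q) ≡ rest p q x
    rest-∘-transp x = sumExcept-cong (λ i i≢p i≢q → cong (λ v → 𝟙 (X? (x v)) * toℕ i) (transp-fix i≢p i≢q))

  -- If c ∈ X implies d ∈ X, an ascending edge with label (c d) can only move values of X to
  -- earlier positions.
  potential-edge : ∀ {x} → Invertible x → ∀ {c d} → c < d → (X c → X d) →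
    len x ℕ.< len (transp c d ∘ x) → potential (transp c d ∘ x) ℕ.≤ potential x
  potential-edge {x} Ix {c} {d} c<d closed ascent = begin
    potential (transp c d ∘ x)
      ≡⟨ potential-cong (transp-values≈transp-positions (invertible⇒injective Ix) (x-inv Ix c) (x-inv Ix d)) ⟩
    potential (x ∘ transp p q)
      ≡⟨ potential-split (x ∘ transp p q) p≢q ⟩
    𝟙 (X? (x (transp p q p))) * toℕ p + 𝟙 (X? (x (transp p q q))) * toℕ q + rest p q (x ∘ transp p q)
      ≡⟨ cong₂ _+_ (cong₂ (λ u v → 𝟙 (X? u) * toℕ p + 𝟙 (X? v) * toℕ q) at-p at-q) (rest-∘-transp x) ⟩
    𝟙 (X? d) * toℕ p + 𝟙 (X? c) * toℕ q + rest p q x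
      ≤⟨ ℕP.+-monoˡ-≤ (rest p q x) (𝟙-rearrangement (X? c) (X? d) closed (ℕP.<⇒≤ p<q)) ⟩
    𝟙 (X? c) * toℕ p + 𝟙 (X? d) * toℕ q + rest p q x
      ≡⟨ cong₂ (λ u v → 𝟙 (X? u) * toℕ p + 𝟙 (X? v) * toℕ q + rest p q x) (x-inv Ix c) (x-inv Ix d) ⟨
    𝟙 (X? (x p)) * toℕ p + 𝟙 (X? (x q)) * toℕ q + rest p q x
      ≡⟨ potential-split x p≢q ⟨
    potential x ∎
    where
      open ℕP.≤-Reasoning
      p = inv Ix c
      q = inv Ix d
      p<q = ascent⇒ordered Ix c<d ascent
      p≢q = FP.<⇒≢ p<q
      at-p : x (transp p q p) ≡ d
      at-p = trans (cong x (transp-at₁ p q)) (x-inv Ix d)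
      at-q : x (transp p q q) ≡ c
      at-q = trans (cong x (transp-at₂ p q)) (x-inv Ix c)

  potential-transp : ∀ {a b} → a < b → X a → ¬ X b → potential id ℕ.< potential (transp a b)
  potential-transp {a} {b} a<b Xa ¬Xb = begin-strict
    potential id
      ≡⟨ potential-split id a≢b ⟩
    𝟙 (X? a) * toℕ a + 𝟙 (X? b) * toℕ b + rest a b id
      ≡⟨ cong₂ (λ u v → u * toℕ a + v * toℕ b + rest a b id) (𝟙-yes (X? a) Xa) (𝟙-no (X? b) ¬Xb) ⟩
    1 * toℕ a + 0 * toℕ b + rest a b id
      <⟨ ℕP.+-monoˡ-< (rest a b id) (subst₂ ℕ._<_ (sym (only-first (toℕ a) (toℕ b))) (sym (only-second (toℕ a) (toℕ b))) a<b) ⟩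
    0 * toℕ a + 1 * toℕ b + rest a b id
      ≡⟨ cong₂ (λ u v → u * toℕ a + v * toℕ b + rest a b id) (𝟙-no (X? b) ¬Xb) (𝟙-yes (X? a) Xa) ⟨
    𝟙 (X? b) * toℕ a + 𝟙 (X? a) * toℕ b + rest a b id
      ≡⟨ cong₂ (λ u v → 𝟙 (X? u) * toℕ a + 𝟙 (X? v) * toℕ b + rest a b id) (transp-at₁ a b) (transp-at₂ a b) ⟨
    𝟙 (X? (transp a b a)) * toℕ a + 𝟙 (X? (transp a b b)) * toℕ b + rest a b id
      ≡⟨ cong (𝟙 (X? (transp a b a)) * toℕ a + 𝟙 (X? (transp a b b)) * toℕ b +_) (rest-∘-transp id) ⟨
    _ ≡⟨ potential-split (transp a b) a≢b ⟨
    potential (transp a b) ∎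
    where
      open ℕP.≤-Reasoning
      a≢b = FP.<⇒≢ a<b
      only-first : ∀ u v → 1 * u + 0 * v ≡ u
      only-first = solve-∀
      only-second : ∀ u v → 0 * u + 1 * v ≡ v
      only-second = solve-∀

  potential-reach : ∀ {σ τ y} → (∀ {c d} → c < d → TL∪ σ τ c d → X c → X d) →
    BruhatReach σ τ y → potential y ℕ.≤ potential id
  potential-reach closed (start y≈id) = ℕP.≤-reflexive (potential-cong y≈id)
  potential-reach closed (step {x} {y} c d c<d l r ascent y≈) = begin
    potential y                 ≡⟨ potential-cong y≈ ⟩
    potential (transp c d ∘ x)  ≤⟨ potential-edge (BruhatReach-invertible r) c<d (closed c<d l) ascent ⟩
    potential x                 ≤⟨ potential-reach closed r ⟩
    potential id                ∎
    where open ℕP.≤-Reasoning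

BruhatReach⇒InTL : ∀ {n} {σ τ ρ : Fun n} → Invertible ρ → (∀ {c d} → c < d → TL∪ σ τ c d → InTL ρ c d) →
  ∀ {a b} → a < b → BruhatReach σ τ (transp a b) → InTL ρ a b
BruhatReach⇒InTL {σ = σ} {τ} {ρ} Iρ TL∪⊆TLρ {a} {b} a<b reach with inv Iρ b ≤? inv Iρ a
... | yes b-before-a = inverted⇒InTL Iρ a<b (FP.≤∧≢⇒< b-before-a (λ eq → FP.<⇒≢ a<b
        (trans (sym (x-inv Iρ a)) (trans (cong ρ (sym eq)) (x-inv Iρ b)))))
... | no b-after-a = ⊥-elim (ℕP.<-irrefl refl (ℕP.<-≤-trans
        (potential-transp X? a<b ℕP.≤-refl b-after-a) (potential-reach X? closed reach)))
  where
    X? : ∀ v → Dec (inv Iρ v ≤ inv Iρ a)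
    X? v = inv Iρ v ≤? inv Iρ a
    closed : ∀ {c d} → c < d → TL∪ σ τ c d → inv Iρ c ≤ inv Iρ a → inv Iρ d ≤ inv Iρ a
    closed c<d l c-before-a = ℕP.<⇒≤ (ℕP.<-≤-trans (InTL⇒inverted Iρ c<d (TL∪⊆TLρ c<d l)) c-before-a)

InTL⇒BruhatReach : ∀ {n} {σ τ ρ : Fun n} → Invertible σ → Invertible τ →
  (∀ π → σ ≤R π → τ ≤R π → ρ ≤R π) → ∀ {a b} → a < b → InTL ρ a b → BruhatReach σ τ (transp a b)
InTL⇒BruhatReach {σ = σ} {τ} {ρ} Iσ Iτ least {a} {b} a<b descent = go (chain? (TL∪? σ τ) a b)
  where
    along : (∃ λ y → (y ≈ transp a b) × Star (Edge (Bounded (TL∪ σ τ) b)) id y) → BruhatReach σ τ (transp a b)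
    along (y , y≈ , path) = BruhatReach-≈ y≈ (BruhatReach-along (start (λ _ → refl)) (Star.map (Edge-map proj₁) path))
    separated : (∃ λ π → Invertible π × (∀ {c d} → c < d → TL∪ σ τ c d → InTL π c d) × ¬ InTL π a b) → ⊥
    separated (π , Iπ , TL∪⊆TLπ , ¬descent) = ¬descent (≤R⇒⊆TL ρ≤π a<b descent)
      where
        σ⊆TLπ : σ ⊆TL π
        σ⊆TLπ c<d σ-descent = TL∪⊆TLπ c<d (inj₁ σ-descent)
        τ⊆TLπ : τ ⊆TL π
        τ⊆TLπ c<d τ-descent = TL∪⊆TLπ c<d (inj₂ τ-descent)
        ρ≤π : ρ ≤R π
        ρ≤π = least π (⊆TL⇒≤R Iσ Iπ σ⊆TLπ) (⊆TL⇒≤R Iτ Iπ τ⊆TLπ)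
    go : Dec (Chain (TL∪ σ τ) a b) → BruhatReach σ τ (transp a b)
    go (yes chain) = along (chain⇒path chain a<b)
    go (no ¬chain) = ⊥-elim (separated (separating-permutation (TL∪? σ τ) a a<b ¬chain))

mainTheorem5 : (n : ℕ) (σ τ ρ : Fun n) → Injective _≡_ _≡_ σ → Injective _≡_ _≡_ τ →
                 IsJoinR σ τ ρ →
                 (a b : Fin n) → a < b →
                 (InTL ρ a b → BruhatReach σ τ (transp a b)) × (BruhatReach σ τ (transp a b) → InTL ρ a b)
mainTheorem5 n σ τ ρ σ-injective τ-injective (σ≤ρ , τ≤ρ , least) a b a<b =
  InTL⇒BruhatReach (injective⇒invertible σ σ-injective) (injective⇒invertible τ τ-injective) least a<b ,
  BruhatReach⇒InTL (≤R⇒invertible σ≤ρ) TL∪⊆TLρ a<b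
  where
    TL∪⊆TLρ : ∀ {c d} → c < d → TL∪ σ τ c d → InTL ρ c d
    TL∪⊆TLρ c<d (inj₁ σ-descent) = ≤R⇒⊆TL σ≤ρ c<d σ-descent
    TL∪⊆TLρ c<d (inj₂ τ-descent) = ≤R⇒⊆TL τ≤ρ c<d τ-descent
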